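{- Let $\mathsf e\in\{\mathsf w,\mathsf s\}$ and let $M$ be a computation that has a $\to_{\sigma\beta_c}$-normal form $N$ (i.e. $M\to_{\sigma\beta_c}^* N$ with $N$ $\to_{\sigma\beta_c}$-normal). Then every maximal $\Rightarrow_{\mathsf e}$-sequence from $M$ is finite and ends in $N$.
   Context: The computational core $\lambda_{\copyright}$ has values $V,W ::= x \mid \lambda x.M$ and computations $M,N,L ::= \,!V \mid VM$ ($x$ ranging over a countable set of variables, terms up to $\alpha$-renaming). Rules: $\beta_c$: $(\lambda x.M)(!V) \mapsto M\{V/x\}$; $\sigma$: $(\lambda y.N)((\lambda x.M)L) \mapsto (\lambda x.(\lambda y.N)M)L$ provided $x\notin \mathrm{fv}(N)$; $\sigma\beta_c=\sigma\cup\beta_c$. Contexts: $C ::= [\,] \mid\, !(\lambda x.C) \mid VC \mid (\lambda x.C)M$; surface contexts $S ::= [\,]\mid VS\mid(\lambda x.S)M$; weak contexts $W ::= [\,]\mid VW$. $\to_{\sigma\beta_c}$, $\to^{\mathsf s}_{\sigma\beta_c}$, $\to^{\mathsf w}_{\sigma\beta_c}$ are the closures of $\sigma\beta_c$ under all, surface, weak contexts respectively; write $\to^{\mathsf e}$ for $\to^{\mathsf e}_{\sigma\beta_c}$. The iterated reduction $\Rightarrow_{\mathsf e}$ is defined inductively: (i) if $M\to^{\mathsf e} M'$ then $M\Rightarrow_{\mathsf e} M'$; (ii) if $M$ is $\to^{\mathsf e}$-normal, then: $!(\lambda x.P)\Rightarrow_{\mathsf e} !(\lambda x.P')$ whenever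 $P\Rightarrow_{\mathsf e}P'$; $(\lambda x.P)Q\Rightarrow_{\mathsf e}(\lambda x.P')Q$ whenever $P\Rightarrow_{\mathsf e}P'$; and $VQ\Rightarrow_{\mathsf e} VQ'$ whenever $V$ is $\sigma\beta_c$-normal (contains no $\sigma\beta_c$-redex) and $Q\Rightarrow_{\mathsf e}Q'$. A maximal sequence is one that is infinite or ends in a term with no further step. -}

module Defs where

open import Data.Nat using (ℕ; zero; suc)
open import Data.Fin using (Fin; zero; suc)
open import Data.Product using (∃; _×_)
open import Data.Unit using (⊤)
open import Relation.Nullary using (¬_)
open import Relation.Binary.Construct.Closure.ReflexiveTransitive using (Star)

-- Terms of λ© in de Bruijn notation (terms up to α-renaming),
-- scoped by the number n of free variables.
mutual
  data Val (n : ℕ) : Set where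
    var : Fin n → Val n
    lam : Comp (suc n) → Val n

  data Comp (n : ℕ) : Set where
    ret : Val n → Comp n            -- !V
    app : Val n → Comp n → Comp n

ext : ∀ {n m} → (Fin n → Fin m) → Fin (suc n) → Fin (suc m)
ext ρ zero    = zero
ext ρ (suc i) = suc (ρ i)

mutual
  renV : ∀ {n m} → (Fin n → Fin m) → Val n → Val m
  renV ρ (var x) = var (ρ x)
  renV ρ (lam M) = lam (renC (ext ρ) M)

  renC : ∀ {n m} → (Fin n → Fin m) → Comp n → Comp m
  renC ρ (ret V)   = ret (renV ρ V)
  renC ρ (app V M) = app (renV ρ V) (renC ρ M)

wkV : ∀ {n} → Val n → Val (suc n)
wkV = renV suc

exts : ∀ {n m} → (Fin n → Val m) → Fin (suc n) → Val (suc m)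
exts σ zero    = var zero
exts σ (suc i) = wkV (σ i)

mutual
  subV : ∀ {n m} → (Fin n → Val m) → Val n → Val m
  subV σ (var x) = σ x
  subV σ (lam M) = lam (subC (exts σ) M)

  subC : ∀ {n m} → (Fin n → Val m) → Comp n → Comp m
  subC σ (ret V)   = ret (subV σ V)
  subC σ (app V M) = app (subV σ V) (subC σ M)

single : ∀ {n} → Val n → Fin (suc n) → Val n
single V zero    = V
single V (suc i) = var i

-- M{V/x}, x the variable bound at index 0
_[_] : ∀ {n} → Comp (suc n) → Val n → Comp n
M [ V ] = subC (single V) M

data _↦_ {n : ℕ} : Comp n → Comp n → Set where
  βc : ∀ (M : Comp (suc n)) (V : Val n) →
       app (lam M) (ret V) ↦ (M [ V ])
  -- (λy.N)((λx.M)L) ↦ (λx.(λy.N)M)L ; x ∉ fv(N) is built in by weakening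
  σ  : ∀ (N : Comp (suc n)) (M : Comp (suc n)) (L : Comp n) →
       app (lam N) (app (lam M) L) ↦ app (lam (app (wkV (lam N)) M)) L

data _⟶_ {n : ℕ} : Comp n → Comp n → Set where
  root  : ∀ {M M'} → M ↦ M' → M ⟶ M'
  inRet : ∀ {P P'} → P ⟶ P' → ret (lam P) ⟶ ret (lam P')
  inArg : ∀ {V M M'} → M ⟶ M' → app V M ⟶ app V M'
  inFun : ∀ {P P' M} → P ⟶ P' → app (lam P) M ⟶ app (lam P') M

data Mode : Set where
  w s : Mode

-- Closure under weak contexts (W ::= [] | V W) and surface contexts
-- (S ::= [] | V S | (λx.S) M)
data _⟶[_]_ {n : ℕ} : Comp n → Mode → Comp n → Set where
  root  : ∀ {e M M'} → M ↦ M' → M ⟶[ e ] M'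
  inArg : ∀ {e V M M'} → M ⟶[ e ] M' → app V M ⟶[ e ] app V M'
  inFun : ∀ {P P' M} → P ⟶[ s ] P' → app (lam P) M ⟶[ s ] app (lam P') M

Normal : ∀ {n} → Comp n → Set
Normal M = ¬ ∃ λ M' → M ⟶ M'

NormalV : ∀ {n} → Val n → Set
NormalV (var x) = ⊤
NormalV (lam P) = Normal P

Normal[_] : ∀ {n} → Mode → Comp n → Set
Normal[ e ] M = ¬ ∃ λ M' → M ⟶[ e ] M'

data _⇒[_]_ {n : ℕ} : Comp n → Mode → Comp n → Set where
  step  : ∀ {e M M'} → M ⟶[ e ] M' → M ⇒[ e ] M'
  inRet : ∀ {e P P'} → Normal[ e ] (ret (lam P)) →
          P ⇒[ e ] P' → ret (lam P) ⇒[ e ] ret (lam P')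
  inFun : ∀ {e P P' Q} → Normal[ e ] (app (lam P) Q) →
          P ⇒[ e ] P' → app (lam P) Q ⇒[ e ] app (lam P') Q
  inArg : ∀ {e V Q Q'} → Normal[ e ] (app V Q) → NormalV V →
          Q ⇒[ e ] Q' → app V Q ⇒[ e ] app V Q'

Normal⇒[_] : ∀ {n} → Mode → Comp n → Set
Normal⇒[ e ] M = ¬ ∃ λ M' → M ⇒[ e ] M'

_⟶*_ : ∀ {n} → Comp n → Comp n → Set
_⟶*_ = Star _⟶_

_⇒*[_]_ : ∀ {n} → Comp n → Mode → Comp n → Set
M ⇒*[ e ] M' = Star (λ A B → A ⇒[ e ] B) M M'

-- σβc-reduction is confluent: β by Takahashi's parallel reduction, σ by Newman's
-- lemma (σ decreases a weight φ), and the two commute. A term with a normal form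
-- is also weakly and surface normalising: weak β-reduction factorises out of
-- parallel β-reduction and can be moved before σ-steps, and a surface normal form
-- is assembled from weak normal forms of the subterms. Modulo σ-normalisation,
-- weak and surface β-reduction are quasi-diamonds, so they are even strongly
-- normalising there. The iterated reduction ⇒ₑ performs →ₑ-steps as long as it
-- can and then works inside subterms of the normal form, so it terminates; a
-- ⇒ₑ-normal form is σβc-normal, hence equal to N by confluence.

module Submission where

open import Defs
open import Data.Empty using (⊥; ⊥-elim)
open import Data.Fin using (Fin; zero; suc)
open import Data.Nat using (ℕ; zero; suc; _+_; _*_; _<_; s≤s; z≤n)
open import Data.Nat.Induction using (<-wellFounded)
open import Data.Nat.Properties using (+-monoʳ-<; +-monoˡ-<; *-monoʳ-<; m<m+n; m≤m+n; m≤n+m; n≤1+n; ≤-trans; <-trans; <-≤-trans)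
open import Data.Nat.Tactic.RingSolver using (solve-∀)
open import Data.Product using (Σ; ∃; _×_; _,_; -,_; proj₁; proj₂)
open import Data.Sum using (_⊎_; inj₁; inj₂)
open import Data.Unit using (⊤; tt)
open import Function using (_∘_; flip)
open import Induction.WellFounded using (Acc; acc; WellFounded; module Subrelation)
open import Relation.Nullary using (¬_; Dec; yes; no)
open import Relation.Binary.Rewriting using (IsNormalForm; HasNormalForm; Confluent; sn&wcr⇒cr)
open import Relation.Binary.Construct.Closure.Transitive using (Plus; _∼⁺⟨_⟩_) renaming ([_] to plus-one)
open import Relation.Binary.Construct.On using () renaming (wellFounded to on-wellFounded)
open import Relation.Binary.PropositionalEquality hiding ([_])
open import Relation.Binary.Construct.Closure.ReflexiveTransitive using (Star; ε; _◅_; _◅◅_; gmap; map; _⋆)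

ext-cong : ∀ {n m} {ρ ρ′ : Fin n → Fin m} → ρ ≗ ρ′ → ext ρ ≗ ext ρ′
ext-cong eq zero    = refl
ext-cong eq (suc i) = cong suc (eq i)

exts-cong : ∀ {n m} {τ τ′ : Fin n → Val m} → τ ≗ τ′ → exts τ ≗ exts τ′
exts-cong eq zero    = refl
exts-cong eq (suc i) = cong wkV (eq i)

mutual
  subV-cong : ∀ {n m} {τ τ′ : Fin n → Val m} → τ ≗ τ′ → ∀ V → subV τ V ≡ subV τ′ V
  subV-cong eq (var x) = eq x
  subV-cong eq (lam M) = cong lam (subC-cong (exts-cong eq) M)

  subC-cong : ∀ {n m} {τ τ′ : Fin n → Val m} → τ ≗ τ′ → ∀ M → subC τ M ≡ subC τ′ M
  subC-cong eq (ret V)   = cong ret (subV-cong eq V)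
  subC-cong eq (app V M) = cong₂ app (subV-cong eq V) (subC-cong eq M)

mutual
  renV-cong : ∀ {n m} {ρ ρ′ : Fin n → Fin m} → ρ ≗ ρ′ → ∀ V → renV ρ V ≡ renV ρ′ V
  renV-cong eq (var x) = cong var (eq x)
  renV-cong eq (lam M) = cong lam (renC-cong (ext-cong eq) M)

  renC-cong : ∀ {n m} {ρ ρ′ : Fin n → Fin m} → ρ ≗ ρ′ → ∀ M → renC ρ M ≡ renC ρ′ M
  renC-cong eq (ret V)   = cong ret (renV-cong eq V)
  renC-cong eq (app V M) = cong₂ app (renV-cong eq V) (renC-cong eq M)

mutual
  renV-renV : ∀ {n m k} (ρ′ : Fin m → Fin k) (ρ : Fin n → Fin m) V →
              renV ρ′ (renV ρ V) ≡ renV (ρ′ ∘ ρ) V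
  renV-renV ρ′ ρ (var x) = refl
  renV-renV ρ′ ρ (lam M) =
    cong lam (trans (renC-renC (ext ρ′) (ext ρ) M) (renC-cong (λ { zero → refl ; (suc i) → refl }) M))

  renC-renC : ∀ {n m k} (ρ′ : Fin m → Fin k) (ρ : Fin n → Fin m) M →
              renC ρ′ (renC ρ M) ≡ renC (ρ′ ∘ ρ) M
  renC-renC ρ′ ρ (ret V)   = cong ret (renV-renV ρ′ ρ V)
  renC-renC ρ′ ρ (app V M) = cong₂ app (renV-renV ρ′ ρ V) (renC-renC ρ′ ρ M)

mutual
  subV-renV : ∀ {n m k} (τ : Fin m → Val k) (ρ : Fin n → Fin m) V →
              subV τ (renV ρ V) ≡ subV (τ ∘ ρ) V
  subV-renV τ ρ (var x) = refl
  subV-renV τ ρ (lam M) =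
    cong lam (trans (subC-renC (exts τ) (ext ρ) M) (subC-cong (λ { zero → refl ; (suc i) → refl }) M))

  subC-renC : ∀ {n m k} (τ : Fin m → Val k) (ρ : Fin n → Fin m) M →
              subC τ (renC ρ M) ≡ subC (τ ∘ ρ) M
  subC-renC τ ρ (ret V)   = cong ret (subV-renV τ ρ V)
  subC-renC τ ρ (app V M) = cong₂ app (subV-renV τ ρ V) (subC-renC τ ρ M)

renV-wkV : ∀ {n m} (ρ : Fin n → Fin m) V → renV (ext ρ) (wkV V) ≡ wkV (renV ρ V)
renV-wkV ρ V = trans (renV-renV (ext ρ) suc V) (sym (renV-renV suc ρ V))

mutual
  renV-subV : ∀ {n m k} (ρ : Fin m → Fin k) (τ : Fin n → Val m) V →
              renV ρ (subV τ V) ≡ subV (renV ρ ∘ τ) V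
  renV-subV ρ τ (var x) = refl
  renV-subV ρ τ (lam M) = cong lam (trans (renC-subC (ext ρ) (exts τ) M) (subC-cong ext-exts M))
    where
    ext-exts : renV (ext ρ) ∘ exts τ ≗ exts (renV ρ ∘ τ)
    ext-exts zero    = refl
    ext-exts (suc i) = renV-wkV ρ (τ i)

  renC-subC : ∀ {n m k} (ρ : Fin m → Fin k) (τ : Fin n → Val m) M →
              renC ρ (subC τ M) ≡ subC (renV ρ ∘ τ) M
  renC-subC ρ τ (ret V)   = cong ret (renV-subV ρ τ V)
  renC-subC ρ τ (app V M) = cong₂ app (renV-subV ρ τ V) (renC-subC ρ τ M)

subV-wkV : ∀ {n m} (τ : Fin n → Val m) V → subV (exts τ) (wkV V) ≡ wkV (subV τ V)
subV-wkV τ V = trans (subV-renV (exts τ) suc V) (sym (renV-subV suc τ V))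

mutual
  subV-subV : ∀ {n m k} (τ′ : Fin m → Val k) (τ : Fin n → Val m) V →
              subV τ′ (subV τ V) ≡ subV (subV τ′ ∘ τ) V
  subV-subV τ′ τ (var x) = refl
  subV-subV τ′ τ (lam M) = cong lam (trans (subC-subC (exts τ′) (exts τ) M) (subC-cong exts-exts M))
    where
    exts-exts : subV (exts τ′) ∘ exts τ ≗ exts (subV τ′ ∘ τ)
    exts-exts zero    = refl
    exts-exts (suc i) = subV-wkV τ′ (τ i)

  subC-subC : ∀ {n m k} (τ′ : Fin m → Val k) (τ : Fin n → Val m) M →
              subC τ′ (subC τ M) ≡ subC (subV τ′ ∘ τ) M
  subC-subC τ′ τ (ret V)   = cong ret (subV-subV τ′ τ V)
  subC-subC τ′ τ (app V M) = cong₂ app (subV-subV τ′ τ V) (subC-subC τ′ τ M)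

mutual
  subV-var : ∀ {n} (V : Val n) → subV var V ≡ V
  subV-var (var x) = refl
  subV-var (lam M) = cong lam (trans (subC-cong (λ { zero → refl ; (suc i) → refl }) M) (subC-var M))

  subC-var : ∀ {n} (M : Comp n) → subC var M ≡ M
  subC-var (ret V)   = cong ret (subV-var V)
  subC-var (app V M) = cong₂ app (subV-var V) (subC-var M)

mutual
  renV-as-subV : ∀ {n m} (ρ : Fin n → Fin m) V → renV ρ V ≡ subV (var ∘ ρ) V
  renV-as-subV ρ (var x) = refl
  renV-as-subV ρ (lam M) =
    cong lam (trans (renC-as-subC (ext ρ) M) (subC-cong (λ { zero → refl ; (suc i) → refl }) M))

  renC-as-subC : ∀ {n m} (ρ : Fin n → Fin m) M → renC ρ M ≡ subC (var ∘ ρ) M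
  renC-as-subC ρ (ret V)   = cong ret (renV-as-subV ρ V)
  renC-as-subC ρ (app V M) = cong₂ app (renV-as-subV ρ V) (renC-as-subC ρ M)

[]-wkV : ∀ {n} (U V : Val n) → subV (single U) (wkV V) ≡ V
[]-wkV U V = trans (subV-renV (single U) suc V) (subV-var V)

_∷ₛ_ : ∀ {n m} → Val m → (Fin n → Val m) → Fin (suc n) → Val m
(U ∷ₛ τ) zero    = U
(U ∷ₛ τ) (suc i) = τ i

subC-exts-[] : ∀ {n m} (τ : Fin n → Val m) (P : Comp (suc n)) (U : Val m) →
               subC (exts τ) P [ U ] ≡ subC (U ∷ₛ τ) P
subC-exts-[] τ P U = trans (subC-subC (single U) (exts τ) P) (subC-cong pointwise P)
  where
  pointwise : subV (single U) ∘ exts τ ≗ (U ∷ₛ τ)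
  pointwise zero    = refl
  pointwise (suc i) = []-wkV U (τ i)

subC-[] : ∀ {n m} (τ : Fin n → Val m) (P : Comp (suc n)) (U : Val n) →
          subC τ (P [ U ]) ≡ subC (subV τ U ∷ₛ τ) P
subC-[] τ P U = trans (subC-subC τ (single U) P) (subC-cong (λ { zero → refl ; (suc i) → refl }) P)

subC-[]-comm : ∀ {n m} (τ : Fin n → Val m) (P : Comp (suc n)) (U : Val n) →
               subC (exts τ) P [ subV τ U ] ≡ subC τ (P [ U ])
subC-[]-comm τ P U = trans (subC-exts-[] τ P (subV τ U)) (sym (subC-[] τ P U))

data Rule : Set where
  β σ : Rule

data Root {n : ℕ} : Rule → Comp n → Comp n → Set where
  βc : ∀ M V → Root β (app (lam M) (ret V)) (M [ V ])
  σ  : ∀ N M L → Root σ (app (lam N) (app (lam M) L)) (app (lam (app (wkV (lam N)) M)) L)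

-- Weak contexts W, surface contexts S and all contexts C: the hole may lie in
-- (λx.[ ])M only if FunBody, and in !(λx.[ ]) only if RetBody.
data Ctx : Set where
  weak surface full : Ctx

FunBody : Ctx → Set
FunBody weak = ⊥
FunBody _    = ⊤

RetBody : Ctx → Set
RetBody full = ⊤
RetBody _    = ⊥

data Step (r : Rule) (c : Ctx) : ∀ {n} → Comp n → Comp n → Set where
  root : ∀ {n} {M M′ : Comp n} → Root r M M′ → Step r c M M′
  arg  : ∀ {n} {V : Val n} {M M′} → Step r c M M′ → Step r c (app V M) (app V M′)
  fun  : ∀ {n} {P P′ : Comp (suc n)} {M} → FunBody c → Step r c P P′ →
         Step r c (app (lam P) M) (app (lam P′) M)
  body : ∀ {n} {P P′ : Comp (suc n)} → RetBody c → Step r c P P′ →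
         Step r c (ret (lam P)) (ret (lam P′))

Red : Ctx → ∀ {n} → Comp n → Comp n → Set
Red c M M′ = Σ Rule λ r → Step r c M M′

NF : Ctx → ∀ {n} → Comp n → Set
NF c = IsNormalForm (Red c)

ctx : Mode → Ctx
ctx w = weak
ctx s = surface

root⇒↦ : ∀ {r n} {M M′ : Comp n} → Root r M M′ → M ↦ M′
root⇒↦ (βc M V)  = βc M V
root⇒↦ (σ N M L) = σ N M L

↦⇒root : ∀ {n} {M M′ : Comp n} → M ↦ M′ → Σ Rule λ r → Root r M M′
↦⇒root (βc M V)  = -, βc M V
↦⇒root (σ N M L) = -, σ N M L

step⇒⟶ : ∀ {r c n} {M M′ : Comp n} → Step r c M M′ → M ⟶ M′
step⇒⟶ (root ρ)   = root (root⇒↦ ρ)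
step⇒⟶ (arg st)   = inArg (step⇒⟶ st)
step⇒⟶ (fun _ st) = inFun (step⇒⟶ st)
step⇒⟶ (body _ st) = inRet (step⇒⟶ st)

⟶⇒red : ∀ {n} {M M′ : Comp n} → M ⟶ M′ → Red full M M′
⟶⇒red (root ρ)    = -, root (proj₂ (↦⇒root ρ))
⟶⇒red (inRet st)  = -, body tt (proj₂ (⟶⇒red st))
⟶⇒red (inArg st)  = -, arg (proj₂ (⟶⇒red st))
⟶⇒red (inFun st)  = -, fun tt (proj₂ (⟶⇒red st))

step⇒⟶[] : ∀ {r} e {n} {M M′ : Comp n} → Step r (ctx e) M M′ → M ⟶[ e ] M′
step⇒⟶[] e (root ρ)    = root (root⇒↦ ρ)
step⇒⟶[] e (arg st)    = inArg (step⇒⟶[] e st)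
step⇒⟶[] s (fun _ st)  = inFun (step⇒⟶[] s st)
step⇒⟶[] w (body () _)
step⇒⟶[] s (body () _)

⟶[]⇒red : ∀ {e n} {M M′ : Comp n} → M ⟶[ e ] M′ → Red (ctx e) M M′
⟶[]⇒red (root ρ)   = -, root (proj₂ (↦⇒root ρ))
⟶[]⇒red (inArg st) = -, arg (proj₂ (⟶[]⇒red st))
⟶[]⇒red (inFun st) = -, fun tt (proj₂ (⟶[]⇒red st))

Normal⇒NF : ∀ {n} {N : Comp n} → Normal N → NF full N
Normal⇒NF nf (N′ , _ , st) = nf (N′ , step⇒⟶ st)

NF⇒Normal : ∀ {n} {N : Comp n} → NF full N → Normal N
NF⇒Normal nf (N′ , st) = nf (N′ , ⟶⇒red st)

NF⇒Normal[] : ∀ {e n} {M : Comp n} → NF (ctx e) M → Normal[ e ] M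
NF⇒Normal[] nf (M′ , st) = nf (M′ , ⟶[]⇒red st)

⟶*⇒red* : ∀ {n} {M M′ : Comp n} → M ⟶* M′ → Star (Red full) M M′
⟶*⇒red* = map ⟶⇒red

widen : ∀ {r c n} {M M′ : Comp n} → Step r c M M′ → Step r full M M′
widen (root ρ)    = root ρ
widen (arg st)    = arg (widen st)
widen (fun _ st)  = fun tt (widen st)
widen {c = full} (body _ st) = body tt (widen st)

widen* : ∀ {c n} {M M′ : Comp n} → Star (Red c) M M′ → Star (Red full) M M′
widen* = map λ (r , st) → r , widen st

weak⇒surface : ∀ {r n} {M M′ : Comp n} → Step r weak M M′ → Step r surface M M′
weak⇒surface (root ρ) = root ρ
weak⇒surface (arg st) = arg (weak⇒surface st)

noStep-ret : ∀ {r e n} {V : Val n} {X} → ¬ Step r (ctx e) (ret V) X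
noStep-ret {e = w} (root ())
noStep-ret {e = s} (root ())

root-subC : ∀ {r n m} (τ : Fin n → Val m) {M M′} → Root r M M′ → Root r (subC τ M) (subC τ M′)
root-subC τ (βc M V) = subst (Root β _) (subC-[]-comm τ M V) (βc (subC (exts τ) M) (subV τ V))
root-subC τ (σ N M L) =
  subst (λ X → Root σ (app (lam (subC (exts τ) N)) (app (lam (subC (exts τ) M)) (subC τ L)))
                     (app (lam (app X (subC (exts τ) M))) (subC τ L)))
        (sym (subV-wkV τ (lam N)))
        (σ (subC (exts τ) N) (subC (exts τ) M) (subC τ L))

step-subC : ∀ {r c n m} (τ : Fin n → Val m) {M M′} → Step r c M M′ → Step r c (subC τ M) (subC τ M′)
step-subC τ (root ρ)     = root (root-subC τ ρ)
step-subC τ (arg st)     = arg (step-subC τ st)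
step-subC τ (fun ok st)  = fun ok (step-subC (exts τ) st)
step-subC τ (body ok st) = body ok (step-subC (exts τ) st)

step-renC : ∀ {r c n m} (ρ : Fin n → Fin m) {M M′} → Step r c M M′ → Step r c (renC ρ M) (renC ρ M′)
step-renC ρ {M} {M′} st =
  subst₂ (Step _ _) (sym (renC-as-subC ρ M)) (sym (renC-as-subC ρ M′)) (step-subC (var ∘ ρ) st)

mutual
  φV : ∀ {n} → Val n → ℕ
  φV (var x) = 0
  φV (lam M) = φC M

  φC : ∀ {n} → Comp n → ℕ
  φC (ret V)   = suc (φV V)
  φC (app V M) = φV V + 2 * φC M

mutual
  φV-renV : ∀ {n m} (ρ : Fin n → Fin m) V → φV (renV ρ V) ≡ φV V
  φV-renV ρ (var x) = refl
  φV-renV ρ (lam M) = φC-renC (ext ρ) M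

  φC-renC : ∀ {n m} (ρ : Fin n → Fin m) M → φC (renC ρ M) ≡ φC M
  φC-renC ρ (ret V)   = cong suc (φV-renV ρ V)
  φC-renC ρ (app V M) = cong₂ (λ a b → a + 2 * b) (φV-renV ρ V) (φC-renC ρ M)

φC-pos : ∀ {n} (M : Comp n) → 0 < φC M
φC-pos (ret V)   = s≤s z≤n
φC-pos (app V M) = <-≤-trans (φC-pos M) (≤-trans (m≤m+n (φC M) (φC M + 0)) (m≤n+m (2 * φC M) (φV V)))

-- φ weighs every ! by 2^(number of enclosing argument positions); σ moves L out
-- of the argument of N and so halves its weight.
φ-σ : ∀ {c n} {M M′ : Comp n} → Step σ c M M′ → φC M′ < φC M
φ-σ (root (σ N M L)) = begin-strict
    φC (app (lam (app (wkV (lam N)) M)) L) ≡⟨ cong (λ a → (a + 2 * b) + 2 * c) (φC-renC (ext suc) N) ⟩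
    (a + 2 * b) + 2 * c                    <⟨ m<m+n _ (*-monoʳ-< 2 (φC-pos L)) ⟩
    (a + 2 * b) + 2 * c + 2 * c            ≡⟨ sym (σ-weight a b c) ⟩
    a + 2 * (b + 2 * c)                    ∎
  where
  open Data.Nat.Properties.≤-Reasoning
  a = φC N
  b = φC M
  c = φC L
  σ-weight : ∀ a b c → a + 2 * (b + 2 * c) ≡ ((a + 2 * b) + 2 * c) + 2 * c
  σ-weight = solve-∀
φ-σ (arg {V = V} st)   = +-monoʳ-< (φV V) (*-monoʳ-< 2 (φ-σ st))
φ-σ (fun {M = M} _ st) = +-monoˡ-< (2 * φC M) (φ-σ st)
φ-σ (body _ st)        = s≤s (φ-σ st)

Step* : Rule → Ctx → ∀ {n} → Comp n → Comp n → Set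
Step* r c = Star (Step r c)

arg* : ∀ {r c n} {V : Val n} {M M′} → Step* r c M M′ → Step* r c (app V M) (app V M′)
arg* = gmap _ arg

fun* : ∀ {r c n} {P P′ : Comp (suc n)} {M} → FunBody c → Step* r c P P′ →
       Step* r c (app (lam P) M) (app (lam P′) M)
fun* ok = gmap _ (fun ok)

body* : ∀ {r c n} {P P′ : Comp (suc n)} → RetBody c → Step* r c P P′ →
        Step* r c (ret (lam P)) (ret (lam P′))
body* ok = gmap _ (body ok)

red* : ∀ {r c n} {M M′ : Comp n} → Step* r c M M′ → Star (Red c) M M′
red* = map (-,_)

funBody? : ∀ c → Dec (FunBody c)
funBody? weak    = no λ ()
funBody? surface = yes tt
funBody? full    = yes tt

retBody? : ∀ c → Dec (RetBody c)
retBody? weak    = no λ ()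
retBody? surface = no λ ()
retBody? full    = yes tt

root? : ∀ {n} r (M : Comp n) → Dec (∃ (Root r M))
root? r (ret V)                             = no λ { (_ , ()) }
root? r (app (var x) M)                     = no λ { (_ , ()) }
root? β (app (lam P) (ret V))               = yes (-, βc P V)
root? σ (app (lam P) (ret V))               = no λ { (_ , ()) }
root? β (app (lam P) (app V M))             = no λ { (_ , ()) }
root? σ (app (lam P) (app (var x) M))       = no λ { (_ , ()) }
root? σ (app (lam P) (app (lam M) L))       = yes (-, σ P M L)

mutual
  step? : ∀ {n} r c (M : Comp n) → Dec (∃ (Step r c M))
  step? r c (ret (var x)) = no λ { (_ , root ()) }
  step? r c (ret (lam P)) with retBody? c | step? r c P
  ... | yes ok | yes (_ , st) = yes (-, body ok st)
  ... | no ¬ok | _            = no λ { (_ , root ()) ; (_ , body ok _) → ¬ok ok }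
  ... | yes _  | no ¬st       = no λ { (_ , root ()) ; (_ , body _ st) → ¬st (-, st) }
  step? r c (app V M) with root? r (app V M) | step? r c M
  ... | yes (_ , ρ) | _            = yes (-, root ρ)
  ... | no _        | yes (_ , st) = yes (-, arg st)
  ... | no ¬ρ       | no ¬st       = fun-step? r c V M ¬ρ ¬st

  fun-step? : ∀ {n} r c (V : Val n) M → ¬ ∃ (Root r (app V M)) → ¬ ∃ (Step r c M) →
              Dec (∃ (Step r c (app V M)))
  fun-step? r c (var x) M ¬ρ ¬st = no λ { (_ , root ρ) → ¬ρ (-, ρ) ; (_ , arg st) → ¬st (-, st) }
  fun-step? r c (lam P) M ¬ρ ¬st with funBody? c | step? r c P
  ... | yes ok | yes (_ , st) = yes (-, fun ok st)
  ... | no ¬ok | _ =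
    no λ { (_ , root ρ) → ¬ρ (-, ρ) ; (_ , arg st) → ¬st (-, st) ; (_ , fun ok _) → ¬ok ok }
  ... | yes _ | no ¬stP =
    no λ { (_ , root ρ) → ¬ρ (-, ρ) ; (_ , arg st) → ¬st (-, st) ; (_ , fun _ st) → ¬stP (-, st) }

red? : ∀ {n} c (M : Comp n) → Dec (∃ (Red c M))
red? c M with step? β c M | step? σ c M
... | yes (_ , st) | _            = yes (-, β , st)
... | no _         | yes (_ , st) = yes (-, σ , st)
... | no ¬β        | no ¬σ        = no λ { (_ , β , st) → ¬β (-, st) ; (_ , σ , st) → ¬σ (-, st) }

σ-normalForm : ∀ {n} c (M : Comp n) → ∃ λ R → Step* σ c M R × IsNormalForm (Step σ c) R
σ-normalForm c M = go M (<-wellFounded (φC M))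
  where
  go : ∀ M → Acc _<_ (φC M) → ∃ λ R → Step* σ c M R × IsNormalForm (Step σ c) R
  go M (acc rs) with step? σ c M
  ... | no nf         = M , ε , nf
  ... | yes (M′ , st) = let R , sts , nf = go M′ (rs (φ-σ st)) in R , st ◅ sts , nf

Joinable : ∀ {n} → (Comp n → Comp n → Set) → Comp n → Comp n → Set
Joinable {n} R M N = ∃ λ D → Star R M D × Star R N D

σ-critical : ∀ {n} (N M K : Comp (suc n)) (J : Comp n) →
  Joinable (Step σ full) (app (lam (app (wkV (lam N)) M)) (app (lam K) J))
                 (app (lam N) (app (lam (app (wkV (lam M)) K)) J))
σ-critical N M K J =
  -, root (σ _ K J) ◅ ε ,
     root (σ N _ J) ◅ subst (λ X → Step σ full (app (lam (app (wkV (lam N)) (app (wkV (lam M)) K))) J)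
                                         (app (lam (app (lam (app X (renC (ext suc) M))) K)) J))
                            (sym (renV-wkV suc (lam N)))
                            (fun tt (root (σ _ _ K)))
                    ◅ ε

σ-root-deterministic : ∀ {n} {M N N′ : Comp n} → Root σ M N → Root σ M N′ → N ≡ N′
σ-root-deterministic (σ N M L) (σ .N .M .L) = refl

σ-local-root : ∀ {n} {M N N′ : Comp n} → Root σ M N → Step σ full M N′ → Joinable (Step σ full) N N′
σ-local-root ρ (root ρ′) rewrite σ-root-deterministic ρ ρ′ = -, ε , ε
σ-local-root (σ N M _) (arg (root (σ _ K J))) = σ-critical N M K J
σ-local-root (σ N M L) (arg (arg st))   = -, arg st ◅ ε , root (σ N M _) ◅ ε
σ-local-root (σ N M L) (arg (fun _ st)) = -, fun tt (arg st) ◅ ε , root (σ N _ L) ◅ ε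
σ-local-root (σ N M L) (fun _ st)       = -, fun tt (fun tt (step-renC (ext suc) st)) ◅ ε , root (σ _ M L) ◅ ε

σ-locallyConfluent : ∀ {n} {M N N′ : Comp n} → Step σ full M N → Step σ full M N′ → Joinable (Step σ full) N N′
σ-locallyConfluent (root ρ) st′ = σ-local-root ρ st′
σ-locallyConfluent st (root ρ′) = let D , p , q = σ-local-root ρ′ st in D , q , p
σ-locallyConfluent (arg st) (arg st′) = let _ , p , q = σ-locallyConfluent st st′ in -, arg* p , arg* q
σ-locallyConfluent (arg st) (fun _ st′) = -, fun tt st′ ◅ ε , arg st ◅ ε
σ-locallyConfluent (fun _ st) (arg st′) = -, arg st′ ◅ ε , fun tt st ◅ ε
σ-locallyConfluent (fun _ st) (fun _ st′) =
  let _ , p , q = σ-locallyConfluent st st′ in -, fun* tt p , fun* tt q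
σ-locallyConfluent (body _ st) (body _ st′) =
  let _ , p , q = σ-locallyConfluent st st′ in -, body* tt p , body* tt q

σ-stronglyNormalizing⁺ : ∀ {n} → WellFounded (flip (Plus (Step σ full {n})))
σ-stronglyNormalizing⁺ = Subrelation.wellFounded plus⇒φ< (on-wellFounded φC <-wellFounded)
  where
  plus⇒φ< : ∀ {M N} → Plus (Step σ full) N M → φC M < φC N
  plus⇒φ< (plus-one st)    = φ-σ st
  plus⇒φ< (_ ∼⁺⟨ p ⟩ q) = <-trans (plus⇒φ< q) (plus⇒φ< p)

σ-confluent : ∀ {n} → Confluent (Step σ full {n})
σ-confluent = sn&wcr⇒cr σ-stronglyNormalizing⁺ σ-locallyConfluent

infix 4 _⇛V_ _⇛_ _⇛ₛ_

mutual
  data _⇛V_ {n : ℕ} : Val n → Val n → Set where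
    var : ∀ {x} → var x ⇛V var x
    lam : ∀ {P P′} → P ⇛ P′ → lam P ⇛V lam P′

  data _⇛_ {n : ℕ} : Comp n → Comp n → Set where
    ret : ∀ {V V′} → V ⇛V V′ → ret V ⇛ ret V′
    app : ∀ {V V′ M M′} → V ⇛V V′ → M ⇛ M′ → app V M ⇛ app V′ M′
    βc  : ∀ {P P′ V V′} → P ⇛ P′ → V ⇛V V′ → app (lam P) (ret V) ⇛ P′ [ V′ ]

mutual
  ⇛V-refl : ∀ {n} (V : Val n) → V ⇛V V
  ⇛V-refl (var x) = var
  ⇛V-refl (lam P) = lam (⇛-refl P)

  ⇛-refl : ∀ {n} (M : Comp n) → M ⇛ M
  ⇛-refl (ret V)   = ret (⇛V-refl V)
  ⇛-refl (app V M) = app (⇛V-refl V) (⇛-refl M)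

_⇛ₛ_ : ∀ {n m} → (Fin n → Val m) → (Fin n → Val m) → Set
τ ⇛ₛ τ′ = ∀ x → τ x ⇛V τ′ x

renC-[]-comm : ∀ {n m} (ρ : Fin n → Fin m) (P : Comp (suc n)) (U : Val n) →
               renC (ext ρ) P [ renV ρ U ] ≡ renC ρ (P [ U ])
renC-[]-comm ρ P U = begin
    renC (ext ρ) P [ renV ρ U ]
  ≡⟨ cong₂ _[_] (renC-as-subC (ext ρ) P) (renV-as-subV ρ U) ⟩
    subC (var ∘ ext ρ) P [ subV (var ∘ ρ) U ]
  ≡⟨ cong (_[ _ ]) (subC-cong (λ { zero → refl ; (suc i) → refl }) P) ⟩
    subC (exts (var ∘ ρ)) P [ subV (var ∘ ρ) U ]
  ≡⟨ subC-[]-comm (var ∘ ρ) P U ⟩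
    subC (var ∘ ρ) (P [ U ])
  ≡⟨ sym (renC-as-subC ρ (P [ U ])) ⟩
    renC ρ (P [ U ])
  ∎
  where open ≡-Reasoning

mutual
  ⇛V-renV : ∀ {n m} (ρ : Fin n → Fin m) {V V′} → V ⇛V V′ → renV ρ V ⇛V renV ρ V′
  ⇛V-renV ρ var     = var
  ⇛V-renV ρ (lam p) = lam (⇛-renC (ext ρ) p)

  ⇛-renC : ∀ {n m} (ρ : Fin n → Fin m) {M M′} → M ⇛ M′ → renC ρ M ⇛ renC ρ M′
  ⇛-renC ρ (ret p)   = ret (⇛V-renV ρ p)
  ⇛-renC ρ (app p q) = app (⇛V-renV ρ p) (⇛-renC ρ q)
  ⇛-renC ρ (βc {P′ = P′} {V′ = V′} p q) =
    subst (_ ⇛_) (renC-[]-comm ρ P′ V′) (βc (⇛-renC (ext ρ) p) (⇛V-renV ρ q))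

⇛ₛ-exts : ∀ {n m} {τ τ′ : Fin n → Val m} → τ ⇛ₛ τ′ → exts τ ⇛ₛ exts τ′
⇛ₛ-exts τ⇛ zero    = var
⇛ₛ-exts τ⇛ (suc i) = ⇛V-renV suc (τ⇛ i)

mutual
  ⇛V-subV : ∀ {n m} {τ τ′ : Fin n → Val m} {V V′} → τ ⇛ₛ τ′ → V ⇛V V′ → subV τ V ⇛V subV τ′ V′
  ⇛V-subV τ⇛ (var {x}) = τ⇛ x
  ⇛V-subV τ⇛ (lam p)   = lam (⇛-subC (⇛ₛ-exts τ⇛) p)

  ⇛-subC : ∀ {n m} {τ τ′ : Fin n → Val m} {M M′} → τ ⇛ₛ τ′ → M ⇛ M′ → subC τ M ⇛ subC τ′ M′
  ⇛-subC τ⇛ (ret p)   = ret (⇛V-subV τ⇛ p)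
  ⇛-subC τ⇛ (app p q) = app (⇛V-subV τ⇛ p) (⇛-subC τ⇛ q)
  ⇛-subC {τ′ = τ′} τ⇛ (βc {P′ = P′} {V′ = V′} p q) =
    subst (_ ⇛_) (subC-[]-comm τ′ P′ V′) (βc (⇛-subC (⇛ₛ-exts τ⇛) p) (⇛V-subV τ⇛ q))

⇛-[] : ∀ {n} {P P′ : Comp (suc n)} {V V′} → P ⇛ P′ → V ⇛V V′ → P [ V ] ⇛ P′ [ V′ ]
⇛-[] p q = ⇛-subC (λ { zero → q ; (suc i) → var }) p

mutual
  devV : ∀ {n} → Val n → Val n
  devV (var x) = var x
  devV (lam P) = lam (dev P)

  dev : ∀ {n} → Comp n → Comp n
  dev (ret V)                 = ret (devV V)
  dev (app (var x) M)         = app (var x) (dev M)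
  dev (app (lam P) (ret V))   = dev P [ devV V ]
  dev (app (lam P) (app W M)) = app (lam (dev P)) (dev (app W M))

mutual
  ⇛V-devV : ∀ {n} {V V′ : Val n} → V ⇛V V′ → V′ ⇛V devV V
  ⇛V-devV var     = var
  ⇛V-devV (lam p) = lam (⇛-dev p)

  ⇛-dev : ∀ {n} {M M′ : Comp n} → M ⇛ M′ → M′ ⇛ dev M
  ⇛-dev (ret p)   = ret (⇛V-devV p)
  ⇛-dev (βc p q)  = ⇛-[] (⇛-dev p) (⇛V-devV q)
  ⇛-dev (app var q)              = app var (⇛-dev q)
  ⇛-dev (app (lam p) (ret q))    = βc (⇛-dev p) (⇛V-devV q)
  ⇛-dev (app (lam p) (app q r))  = app (lam (⇛-dev p)) (⇛-dev (app q r))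
  ⇛-dev (app (lam p) (βc q r))   = app (lam (⇛-dev p)) (⇛-dev (βc q r))

⇛-diamond : ∀ {n} {M N N′ : Comp n} → M ⇛ N → M ⇛ N′ → ∃ λ D → N ⇛ D × N′ ⇛ D
⇛-diamond p q = -, ⇛-dev p , ⇛-dev q

module _ {A : Set} where

  Diamond : (A → A → Set) → Set
  Diamond R = ∀ {a b c} → R a b → R a c → ∃ λ d → R b d × R c d

  diamond⇒confluent : ∀ {R : A → A → Set} → Diamond R → Confluent R
  diamond⇒confluent {R} dia = confl
    where
    strip : ∀ {a b c} → R a b → Star R a c → ∃ λ d → Star R b d × R c d
    strip p ε        = -, ε , p
    strip p (q ◅ qs) = let _ , p′ , q′ = dia p q ; _ , ps , r = strip q′ qs in -, p′ ◅ ps , r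

    confl : Confluent R
    confl ε        qs = -, qs , ε
    confl (p ◅ ps) qs = let _ , qs′ , p′ = strip p qs ; _ , u , v = confl ps qs′ in -, u , p′ ◅ v

  union-confluent : ∀ {R S : A → A → Set} → Confluent R → Confluent S →
    (∀ {a b c} → Star R a b → Star S a c → ∃ λ d → Star S b d × Star R c d) →
    Confluent (λ a b → R a b ⊎ S a b)
  union-confluent {R} {S} R-confl S-confl commute p q =
    let _ , u , v = diamond⇒confluent dia (map step→ p) (map step→ q) in -, (flatten ⋆) u , (flatten ⋆) v
    where
    D : A → A → Set
    D a b = Star R a b ⊎ Star S a b

    dia : Diamond D
    dia (inj₁ p) (inj₁ q) = let _ , u , v = R-confl p q in -, inj₁ u , inj₁ v
    dia (inj₂ p) (inj₂ q) = let _ , u , v = S-confl p q in -, inj₂ u , inj₂ v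
    dia (inj₁ p) (inj₂ q) = let _ , u , v = commute p q in -, inj₂ u , inj₁ v
    dia (inj₂ p) (inj₁ q) = let _ , u , v = commute q p in -, inj₁ v , inj₂ u

    step→ : ∀ {a b} → R a b ⊎ S a b → D a b
    step→ (inj₁ p) = inj₁ (p ◅ ε)
    step→ (inj₂ q) = inj₂ (q ◅ ε)

    flatten : ∀ {a b} → D a b → Star (λ a b → R a b ⊎ S a b) a b
    flatten (inj₁ p) = map inj₁ p
    flatten (inj₂ q) = map inj₂ q

β⇒⇛ : ∀ {n} {M M′ : Comp n} → Step β full M M′ → M ⇛ M′
β⇒⇛ (root (βc M V))      = βc (⇛-refl M) (⇛V-refl V)
β⇒⇛ (arg {V = V} st)     = app (⇛V-refl V) (β⇒⇛ st)
β⇒⇛ (fun {M = M} _ st)   = app (lam (β⇒⇛ st)) (⇛-refl M)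
β⇒⇛ (body _ st)          = ret (lam (β⇒⇛ st))

mutual
  ⇛⇒β*-ret : ∀ {n} {V V′ : Val n} → V ⇛V V′ → Step* β full (ret V) (ret V′)
  ⇛⇒β*-ret var     = ε
  ⇛⇒β*-ret (lam p) = body* tt (⇛⇒β* p)

  ⇛⇒β*-fun : ∀ {n} {V V′ : Val n} {M} → V ⇛V V′ → Step* β full (app V M) (app V′ M)
  ⇛⇒β*-fun var     = ε
  ⇛⇒β*-fun (lam p) = fun* tt (⇛⇒β* p)

  ⇛⇒β* : ∀ {n} {M M′ : Comp n} → M ⇛ M′ → Step* β full M M′
  ⇛⇒β* (ret p)   = ⇛⇒β*-ret p
  ⇛⇒β* (app p q) = ⇛⇒β*-fun p ◅◅ arg* (⇛⇒β* q)
  ⇛⇒β* (βc p q)  = fun* tt (⇛⇒β* p) ◅◅ arg* (⇛⇒β*-ret q) ◅◅ root (βc _ _) ◅ ε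

β-confluent : ∀ {n} → Confluent (Step β full {n})
β-confluent p q =
  let _ , u , v = diamond⇒confluent ⇛-diamond (map β⇒⇛ p) (map β⇒⇛ q) in -, (⇛⇒β* ⋆) u , (⇛⇒β* ⋆) v

data ValStep (r : Rule) {n : ℕ} : Val n → Val n → Set where
  lam : ∀ {P P′} → Step r full P P′ → ValStep r (lam P) (lam P′)

ValStep* : Rule → ∀ {n} → Val n → Val n → Set
ValStep* r = Star (ValStep r)

mutual
  subV-valStep* : ∀ {r n m} {τ τ′ : Fin n → Val m} → (∀ x → ValStep* r (τ x) (τ′ x)) →
                  ∀ V → ValStep* r (subV τ V) (subV τ′ V)
  subV-valStep* τ→ (var x) = τ→ x
  subV-valStep* τ→ (lam P) = gmap lam lam (subC-valStep* exts→ P)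
    where
    exts→ : ∀ x → ValStep* _ (exts _ x) (exts _ x)
    exts→ zero    = ε
    exts→ (suc i) = gmap wkV (λ { (lam st) → lam (step-renC (ext suc) st) }) (τ→ i)

  subC-valStep* : ∀ {r n m} {τ τ′ : Fin n → Val m} → (∀ x → ValStep* r (τ x) (τ′ x)) →
                  ∀ M → Step* r full (subC τ M) (subC τ′ M)
  subC-valStep* τ→ (ret V)   = gmap ret (λ { (lam st) → body tt st }) (subV-valStep* τ→ V)
  subC-valStep* τ→ (app V M) =
    gmap (λ W → app W _) (λ { (lam st) → fun tt st }) (subV-valStep* τ→ V) ◅◅ arg* (subC-valStep* τ→ M)

[]-valStep : ∀ {r n} (P : Comp (suc n)) {V V′ : Val n} → ValStep r V V′ → Step* r full (P [ V ]) (P [ V′ ])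
[]-valStep P st = subC-valStep* (λ { zero → st ◅ ε ; (suc i) → ε }) P

β-σ-commute : ∀ {c n} {M N M′ : Comp n} → Step β c M N → Step σ full M M′ →
              ∃ λ D → Step β c M′ D × Step* σ full N D
β-σ-commute (root (βc P V)) (arg (root ()))
β-σ-commute (root (βc P V)) (arg (body _ st)) = -, root (βc P _) , []-valStep P (lam st)
β-σ-commute (root (βc P V)) (fun _ st)        = -, root (βc _ V) , step-subC (single V) st ◅ ε
β-σ-commute (arg (root (βc K U))) (root (σ N .K .(ret U))) =
  -, subst (Step β _ _) (cong (λ X → app X (K [ U ])) ([]-wkV U (lam N))) (root (βc (app (wkV (lam N)) K) U)) , ε
β-σ-commute (arg (arg st))    (root (σ N K L)) = -, arg st , root (σ N K _) ◅ ε
β-σ-commute (arg (fun ok st)) (root (σ N K L)) = -, fun ok (arg st) , root (σ N _ L) ◅ ε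
β-σ-commute (arg st) (arg st′) = let _ , st″ , sts = β-σ-commute st st′ in -, arg st″ , arg* sts
β-σ-commute (arg st) (fun _ st′) = -, arg st , fun tt st′ ◅ ε
β-σ-commute (fun ok st) (root (σ P K L)) = -, fun ok (fun ok (step-renC (ext suc) st)) , root (σ _ K L) ◅ ε
β-σ-commute (fun ok st) (arg st′) = -, fun ok st , arg st′ ◅ ε
β-σ-commute (fun ok st) (fun _ st′) = let _ , st″ , sts = β-σ-commute st st′ in -, fun ok st″ , fun* tt sts
β-σ-commute (body ok st) (body _ st′) = let _ , st″ , sts = β-σ-commute st st′ in -, body ok st″ , body* tt sts

β-σ*-commute : ∀ {c n} {M N M′ : Comp n} → Step β c M N → Step* σ full M M′ →
               ∃ λ D → Step β c M′ D × Step* σ full N D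
β-σ*-commute st ε = -, st , ε
β-σ*-commute st (st′ ◅ sts′) =
  let _ , st″ , sts = β-σ-commute st st′ ; _ , st‴ , sts″ = β-σ*-commute st″ sts′ in -, st‴ , sts ◅◅ sts″

β*-σ*-commute : ∀ {n} {M N M′ : Comp n} → Step* β full M N → Step* σ full M M′ →
                ∃ λ D → Step* σ full N D × Step* β full M′ D
β*-σ*-commute ε sts = -, sts , ε
β*-σ*-commute (st ◅ sts) sts′ =
  let _ , st″ , sts″ = β-σ*-commute st sts′ ; _ , u , v = β*-σ*-commute sts sts″ in -, u , st″ ◅ v

confluent : ∀ {n} → Confluent (Red full {n})
confluent p q =
  let _ , u , v = union-confluent β-confluent σ-confluent β*-σ*-commute (map split p) (map split q)
  in -, map join u , map join v
  where
  split : ∀ {n} {M N : Comp n} → Red full M N → Step β full M N ⊎ Step σ full M N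
  split (β , st) = inj₁ st
  split (σ , st) = inj₂ st

  join : ∀ {n} {M N : Comp n} → Step β full M N ⊎ Step σ full M N → Red full M N
  join (inj₁ st) = -, st
  join (inj₂ st) = -, st

module _ {A : Set} {R : A → A → Set} where

  normalForm-Star : ∀ {a b} → IsNormalForm R a → Star R a b → a ≡ b
  normalForm-Star nf ε       = refl
  normalForm-Star nf (p ◅ _) = ⊥-elim (nf (-, p))

  confluent⇒normalForm-unique : Confluent R → ∀ {a b b′} → Star R a b → Star R a b′ →
                                IsNormalForm R b → IsNormalForm R b′ → b ≡ b′
  confluent⇒normalForm-unique confl p q nf nf′ =
    let _ , u , v = confl p q in trans (normalForm-Star nf u) (sym (normalForm-Star nf′ v))

NF-arg : ∀ {c n} {V : Val n} {M} → NF c (app V M) → NF c M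
NF-arg nf (_ , r , st) = nf (-, r , arg st)

NF-fun : ∀ {c n} {P : Comp (suc n)} {M} → FunBody c → NF c (app (lam P) M) → NF c P
NF-fun ok nf (_ , r , st) = nf (-, r , fun ok st)

NF-body : ∀ {c n} {P : Comp (suc n)} → RetBody c → NF c (ret (lam P)) → NF c P
NF-body ok nf (_ , r , st) = nf (-, r , body ok st)

root-after-arg : ∀ {r r′ n} {V : Val n} {M M′ X} → Step r′ full M M′ → ¬ ∃ (Root r′ M) →
                 Root r (app V M′) X → ∃ (Root r (app V M))
root-after-arg (root ρ)    ¬ρ _          = ⊥-elim (¬ρ (-, ρ))
root-after-arg (arg _)     ¬ρ (σ N _ _)  = -, σ N _ _
root-after-arg (fun _ _)   ¬ρ (σ N _ _)  = -, σ N _ _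
root-after-arg (body _ _)  ¬ρ (βc P _)   = -, βc P _

NF-step : ∀ {c r n} {M M′ : Comp n} → NF c M → Step r full M M′ → NF c M′
NF-step nf (root ρ) _ = nf (-, -, root ρ)
NF-step nf (arg st) (_ , _ , root ρ) =
  nf (-, -, root (proj₂ (root-after-arg st (λ (_ , ρ′) → nf (-, -, arg (root ρ′))) ρ)))
NF-step nf (arg st)    (_ , r , arg st′)    = NF-step (NF-arg nf) st (-, r , st′)
NF-step nf (arg st)    (_ , r , fun ok st′) = nf (-, r , fun ok st′)
NF-step nf (fun _ st)  (_ , _ , root (βc P V))  = nf (-, -, root (βc _ V))
NF-step nf (fun _ st)  (_ , _ , root (σ N K L)) = nf (-, -, root (σ _ K L))
NF-step nf (fun _ st)  (_ , r , arg st′)    = nf (-, r , arg st′)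
NF-step nf (fun _ st)  (_ , r , fun ok st′) = NF-step (NF-fun ok nf) st (-, r , st′)
NF-step nf (body _ st) (_ , _ , root ())
NF-step nf (body _ st) (_ , r , body ok st′) = NF-step (NF-body ok nf) st (-, r , st′)

NF-red* : ∀ {c n} {M M′ : Comp n} → NF c M → Star (Red full) M M′ → NF c M′
NF-red* nf ε                = nf
NF-red* nf ((_ , st) ◅ sts) = NF-red* (NF-step nf st) sts

σ-β-postpone : ∀ {n} {M N D : Comp n} → Step σ full M N → Step β weak N D →
               ∃ λ M′ → Step β weak M M′ × Step* σ full M′ D
σ-β-postpone (root (σ N K .(ret V))) (root (βc .(app (wkV (lam N)) K) V)) =
  -, arg (root (βc K V)) , subst (Step* σ full _) (cong (λ X → app X (K [ V ])) (sym ([]-wkV V (lam N)))) ε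
σ-β-postpone (root (σ N K L)) (arg st)        = -, arg (arg st) , root (σ N K _) ◅ ε
σ-β-postpone (arg (root ())) (root (βc _ _))
σ-β-postpone (arg (body _ st)) (root (βc P _)) = -, root (βc P _) , []-valStep P (lam st)
σ-β-postpone (arg st) (arg st′) = let _ , st″ , sts = σ-β-postpone st st′ in -, arg st″ , arg* sts
σ-β-postpone (fun _ st) (root (βc P V)) = -, root (βc _ V) , step-subC (single V) st ◅ ε
σ-β-postpone (fun _ st) (arg st′)       = -, arg st′ , fun tt st ◅ ε

σ*-β-postpone : ∀ {n} {M N D : Comp n} → Step* σ full M N → Step β weak N D →
                ∃ λ M′ → Step β weak M M′ × Step* σ full M′ D
σ*-β-postpone ε st = -, st , ε
σ*-β-postpone (st ◅ sts) st′ =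
  let _ , st″ , sts′ = σ*-β-postpone sts st′ ; _ , st‴ , sts″ = σ-β-postpone st st″ in -, st‴ , sts″ ◅◅ sts′

-- Internal parallel reduction: no redex in weak position is contracted.
infix 4 _⇛ᵢ_

data _⇛ᵢ_ {n : ℕ} : Comp n → Comp n → Set where
  ret : ∀ {V V′} → V ⇛V V′ → ret V ⇛ᵢ ret V′
  app : ∀ {V V′ M M′} → V ⇛V V′ → M ⇛ᵢ M′ → app V M ⇛ᵢ app V′ M′

⇛-factorise-subC : ∀ {n m} {τ τ′ : Fin n → Val m} {P P′} → τ ⇛ₛ τ′ → P ⇛ P′ →
                   ∃ λ X → Step* β weak (subC τ P) X × X ⇛ᵢ subC τ′ P′
⇛-factorise-subC τ⇛ (ret p)   = -, ε , ret (⇛V-subV τ⇛ p)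
⇛-factorise-subC τ⇛ (app p q) =
  let _ , sts , i = ⇛-factorise-subC τ⇛ q in -, arg* sts , app (⇛V-subV τ⇛ p) i
⇛-factorise-subC {τ = τ} {τ′} τ⇛ (βc {P = P} {P′} {V} {V′} p q) =
  let X , sts , i = ⇛-factorise-subC {τ = subV τ V ∷ₛ τ} {subV τ′ V′ ∷ₛ τ′} τ⇛′ p
  in X , subst (Step β weak _) (subC-exts-[] τ P (subV τ V)) (root (βc _ _)) ◅ sts ,
         subst (X ⇛ᵢ_) (sym (subC-[] τ′ P′ V′)) i
  where
  τ⇛′ : (subV τ V ∷ₛ τ) ⇛ₛ (subV τ′ V′ ∷ₛ τ′)
  τ⇛′ zero    = ⇛V-subV τ⇛ q
  τ⇛′ (suc i) = τ⇛ i

⇛-factorise : ∀ {n} {M M′ : Comp n} → M ⇛ M′ → ∃ λ X → Step* β weak M X × X ⇛ᵢ M′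
⇛-factorise {M = M} {M′} p =
  let X , sts , i = ⇛-factorise-subC (λ _ → var) p
  in X , subst (λ Z → Step* β weak Z X) (subC-var M) sts , subst (X ⇛ᵢ_) (subC-var M′) i

⇛ᵢ-β-postpone : ∀ {n} {M N D : Comp n} → M ⇛ᵢ N → Step β weak N D → ∃ λ M′ → Step β weak M M′ × M′ ⇛ D
⇛ᵢ-β-postpone (app (lam p) (ret q)) (root (βc _ _)) = -, root (βc _ _) , ⇛-[] p q
⇛ᵢ-β-postpone (app p i) (arg st) = let _ , st′ , q = ⇛ᵢ-β-postpone i st in -, arg st′ , app p q

⇛ᵢ-reflects-NF : ∀ {n} {M N : Comp n} → M ⇛ᵢ N → IsNormalForm (Step β weak) N → IsNormalForm (Step β weak) M
⇛ᵢ-reflects-NF (app (lam p) (ret q)) nf (_ , root (βc _ _)) = nf (-, root (βc _ _))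
⇛ᵢ-reflects-NF (app p i) nf (_ , arg st) = ⇛ᵢ-reflects-NF i (λ (_ , st′) → nf (-, arg st′)) (-, st)

⇛-βweakNF-back : ∀ {n} {M M′ R : Comp n} → Step* β weak M′ R → IsNormalForm (Step β weak) R →
                 M ⇛ M′ → HasNormalForm (Step β weak) M
⇛-βweakNF-back sts nf p with ⇛-factorise p
⇛-βweakNF-back ε nf p | X , xs , i = X , ⇛ᵢ-reflects-NF i nf , xs
⇛-βweakNF-back (st ◅ sts) nf p | X , xs , i =
  let _ , st′ , q = ⇛ᵢ-β-postpone i st ; R , nf′ , ys = ⇛-βweakNF-back sts nf q in R , nf′ , xs ◅◅ st′ ◅ ys

σ*-βweakNF-back : ∀ {n} {M M′ R : Comp n} → Step* β weak M′ R → IsNormalForm (Step β weak) R →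
                  Step* σ full M M′ → HasNormalForm (Step β weak) M
σ*-βweakNF-back {M = M} ε nf σs = M , (λ (_ , st) → nf (-, proj₁ (proj₂ (β-σ*-commute st σs)))) , ε
σ*-βweakNF-back (st ◅ sts) nf σs =
  let _ , st′ , σs′ = σ*-β-postpone σs st ; R , nf′ , ys = σ*-βweakNF-back sts nf σs′ in R , nf′ , st′ ◅ ys

βweak-normalising : ∀ {n} {M N : Comp n} → Star (Red full) M N → NF full N → HasNormalForm (Step β weak) M
βweak-normalising {N = N} ε nf = N , (λ (_ , st) → nf (-, -, widen st)) , ε
βweak-normalising ((β , st) ◅ sts) nf = let _ , nf′ , βs = βweak-normalising sts nf in ⇛-βweakNF-back βs nf′ (β⇒⇛ st)
βweak-normalising ((σ , st) ◅ sts) nf = let _ , nf′ , βs = βweak-normalising sts nf in σ*-βweakNF-back βs nf′ (st ◅ ε)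

σweak-preserves-βweakNF : ∀ {n} {M M′ : Comp n} → Step σ weak M M′ →
                          IsNormalForm (Step β weak) M → IsNormalForm (Step β weak) M′
σweak-preserves-βweakNF (root (σ N K L)) nf (_ , root (βc _ W)) = nf (-, arg (root (βc K W)))
σweak-preserves-βweakNF (root (σ N K L)) nf (_ , arg st)        = nf (-, arg (arg st))
σweak-preserves-βweakNF (arg (root ())) nf (_ , root (βc _ _))
σweak-preserves-βweakNF (arg st) nf (_ , arg st′) =
  σweak-preserves-βweakNF st (λ (_ , st″) → nf (-, arg st″)) (-, st′)

weak-normalising : ∀ {n} {M N : Comp n} → Star (Red full) M N → NF full N → HasNormalForm (Red weak) M
weak-normalising p nf =
  let R , βnf , βs = βweak-normalising p nf
      S , σs , σnf = σ-normalForm weak R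
  in S , NF-S (preserve σs βnf) σnf , red* βs ◅◅ red* σs
  where
  preserve : ∀ {n} {R S : Comp n} → Step* σ weak R S → IsNormalForm (Step β weak) R → IsNormalForm (Step β weak) S
  preserve ε          nf = nf
  preserve (st ◅ sts) nf = preserve sts (σweak-preserves-βweakNF st nf)

  NF-S : ∀ {n} {S : Comp n} → IsNormalForm (Step β weak) S → IsNormalForm (Step σ weak) S → NF weak S
  NF-S βnf σnf (_ , β , st) = βnf (-, st)
  NF-S βnf σnf (_ , σ , st) = σnf (-, st)

SN : ∀ {A : Set} → (A → A → Set) → A → Set
SN R = Acc (flip R)

QuasiDiamond : ∀ {A : Set} → (A → A → Set) → Set
QuasiDiamond R = ∀ {a b c} → R a b → R a c → b ≡ c ⊎ ∃ λ d → R b d × R c d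

module _ {A : Set} {R : A → A → Set} where

  private
    data Path : ℕ → A → A → Set where
      []  : ∀ {a} → Path 0 a a
      _∷_ : ∀ {k a b c} → R a b → Path k b c → Path (suc k) a c

    toPath : ∀ {a b} → Star R a b → ∃ λ k → Path k a b
    toPath ε        = -, []
    toPath (p ◅ ps) = -, p ∷ proj₂ (toPath ps)

  -- In a quasi-diamond, every step from a shortens every path to a normal form by one.
  quasiDiamond⇒SN : QuasiDiamond R → ∀ {a T} → Star R a T → IsNormalForm R T → SN R a
  quasiDiamond⇒SN qd ps nf = fromPath (proj₂ (toPath ps))
    where
    shorten : ∀ {k a b} → Path (suc k) a _ → R a b → Path k b _
    shorten (p ∷ []) q with qd p q
    ... | inj₁ refl          = []
    ... | inj₂ (_ , p′ , _)  = ⊥-elim (nf (-, p′))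
    shorten (p ∷ ps@(_ ∷ _)) q with qd p q
    ... | inj₁ refl          = ps
    ... | inj₂ (_ , p′ , q′) = q′ ∷ shorten ps p′

    fromPath : ∀ {k a} → Path k a _ → SN R a
    fromPath []         = acc λ p → ⊥-elim (nf (-, p))
    fromPath ps@(_ ∷ _) = acc λ p → fromPath (shorten ps p)

β-quasiDiamond : ∀ {c n} → ¬ RetBody c → QuasiDiamond (Step β c {n})
β-quasiDiamond _ (root (βc P V)) (root (βc .P .V)) = inj₁ refl
β-quasiDiamond _ (root (βc P V)) (arg (root ()))
β-quasiDiamond shallow (root (βc P V)) (arg (body ok _)) = ⊥-elim (shallow ok)
β-quasiDiamond shallow (arg (body ok _)) (root (βc P V)) = ⊥-elim (shallow ok)
β-quasiDiamond _ (arg (root ())) (root (βc P V))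
β-quasiDiamond _ (root (βc P V)) (fun ok st) = inj₂ (-, step-subC (single V) st , root (βc _ V))
β-quasiDiamond _ (fun ok st) (root (βc P V)) = inj₂ (-, root (βc _ V) , step-subC (single V) st)
β-quasiDiamond shallow (arg st) (arg st′) with β-quasiDiamond shallow st st′
... | inj₁ eq              = inj₁ (cong (app _) eq)
... | inj₂ (_ , st″ , st‴) = inj₂ (-, arg st″ , arg st‴)
β-quasiDiamond _ (arg st)    (fun ok st′) = inj₂ (-, fun ok st′ , arg st)
β-quasiDiamond _ (fun ok st) (arg st′)    = inj₂ (-, arg st′ , fun ok st)
β-quasiDiamond shallow (fun ok st) (fun _ st′) with β-quasiDiamond shallow st st′
... | inj₁ eq              = inj₁ (cong (λ P → app (lam P) _) eq)
... | inj₂ (_ , st″ , st‴) = inj₂ (-, fun ok st″ , fun ok st‴)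
β-quasiDiamond shallow (body ok _) _ = ⊥-elim (shallow ok)

σNF : ∀ {n} → Comp n → Comp n → Set
σNF M R = Step* σ full M R × IsNormalForm (Step σ full) R

σNF-unique : ∀ {n} {M R R′ : Comp n} → σNF M R → σNF M R′ → R ≡ R′
σNF-unique (σs , nf) (σs′ , nf′) = confluent⇒normalForm-unique σ-confluent σs σs′ nf nf′

σNF-σ : ∀ {c n} {M M′ R : Comp n} → Step σ c M M′ → σNF M R → σNF M′ R
σNF-σ st (σs , nf) =
  let _ , u , v = σ-confluent σs (widen st ◅ ε) in subst (Step* σ full _) (sym (normalForm-Star nf u)) v , nf

_⇝[_]_ : ∀ {n} → Comp n → Ctx → Comp n → Set
R ⇝[ c ] R′ = ∃ λ X → Step β c R X × σNF X R′

σNF-β : ∀ {c n} {M M′ R : Comp n} → Step β c M M′ → σNF M R → ∃ λ R′ → R ⇝[ c ] R′ × σNF M′ R′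
σNF-β st (σs , _) =
  let X , st′ , σs′ = β-σ*-commute st σs ; R′ , σsX , nf = σ-normalForm full X
  in R′ , (X , st′ , σsX , nf) , σs′ ◅◅ σsX , nf

⇝-quasiDiamond : ∀ {c n} → ¬ RetBody c → QuasiDiamond (λ (R R′ : Comp n) → R ⇝[ c ] R′)
⇝-quasiDiamond shallow (X₁ , st₁ , nf₁) (X₂ , st₂ , nf₂) with β-quasiDiamond shallow st₁ st₂
... | inj₁ refl = inj₁ (σNF-unique nf₁ nf₂)
... | inj₂ (_ , u₁ , u₂) =
  let R₃ , r₁ , nf₃ = σNF-β u₁ nf₁ ; R₃′ , r₂ , nf₃′ = σNF-β u₂ nf₂
  in inj₂ (R₃ , r₁ , subst (_ ⇝[ _ ]_) (σNF-unique nf₃′ nf₃) r₂)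

⇝-track : ∀ {c n} {M S R : Comp n} → Star (Red c) M S → σNF M R → ∃ λ R′ → Star (_⇝[ c ]_) R R′ × σNF S R′
⇝-track ε nf = -, ε , nf
⇝-track ((σ , st) ◅ sts) nf = ⇝-track sts (σNF-σ st nf)
⇝-track ((β , st) ◅ sts) nf =
  let _ , r , nf′ = σNF-β st nf ; R′ , rs , nf″ = ⇝-track sts nf′ in R′ , r ◅ rs , nf″

-- Lexicographically: a β-step moves along ⇝, a σ-step keeps the σ-normal form and decreases φ.
SN-⇝⇒SN : ∀ {c n} {M R : Comp n} → SN (_⇝[ c ]_) R → σNF M R → SN (Red c) M
SN-⇝⇒SN {c} {M = M} {R} (acc rs) nf = go M nf (<-wellFounded (φC M))
  where
  go : ∀ M → σNF M R → Acc _<_ (φC M) → SN (Red c) M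
  go M nf (acc φrs) = acc λ where
    (σ , st) → go _ (σNF-σ st nf) (φrs (φ-σ st))
    (β , st) → let _ , r , nf′ = σNF-β st nf in SN-⇝⇒SN (rs r) nf′

WN⇒SN : ∀ e {n} {M : Comp n} → HasNormalForm (Red (ctx e)) M → SN (Red (ctx e)) M
WN⇒SN e {M = M} (S , nfS , p) =
  let _ , nfM = σ-normalForm full M ; R′ , rs , σs , _ = ⇝-track p nfM
  in SN-⇝⇒SN (quasiDiamond⇒SN (⇝-quasiDiamond (shallow e)) rs (⇝-normal σs)) nfM
  where
  shallow : ∀ e → ¬ RetBody (ctx e)
  shallow w ()
  shallow s ()

  ⇝-normal : ∀ {R′} → Step* σ full S R′ → IsNormalForm (_⇝[ ctx e ]_) R′
  ⇝-normal σs (_ , _ , st , _) = NF-red* nfS (red* σs) (-, β , st)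

mutual
  sizeV : ∀ {n} → Val n → ℕ
  sizeV (var x) = 1
  sizeV (lam P) = suc (size P)

  size : ∀ {n} → Comp n → ℕ
  size (ret V)   = suc (sizeV V)
  size (app V M) = suc (sizeV V + size M)

size-arg : ∀ {n} (V : Val n) M → size M < size (app V M)
size-arg V M = s≤s (m≤n+m (size M) (sizeV V))

size-fun : ∀ {n} (P : Comp (suc n)) M → size P < size (app (lam P) M)
size-fun P M = s≤s (≤-trans (n≤1+n (size P)) (m≤m+n (suc (size P)) (size M)))

size-body : ∀ {n} (P : Comp (suc n)) → size P < size (ret (lam P))
size-body P = s≤s (n≤1+n (size P))

red-arg* : ∀ {c n} {V : Val n} {M M′} → Star (Red c) M M′ → Star (Red c) (app V M) (app V M′)
red-arg* = gmap _ λ (r , st) → r , arg st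

red-fun* : ∀ {c n} {P P′ : Comp (suc n)} {M} → FunBody c → Star (Red c) P P′ →
           Star (Red c) (app (lam P) M) (app (lam P′) M)
red-fun* ok = gmap _ λ (r , st) → r , fun ok st

red*-var-app : ∀ {n} {x : Fin n} {M N} → Star (Red full) (app (var x) M) N →
               ∃ λ N′ → N ≡ app (var x) N′ × Star (Red full) M N′
red*-var-app ε = -, refl , ε
red*-var-app ((r , arg st) ◅ sts) = let N′ , eq , q = red*-var-app sts in N′ , eq , (r , st) ◅ q

red*-lam-var-app : ∀ {n} {P : Comp (suc n)} {y : Fin n} {M N} → Star (Red full) (app (lam P) (app (var y) M)) N →
  ∃ λ P′ → ∃ λ M′ → N ≡ app (lam P′) (app (var y) M′) × Star (Red full) P P′ × Star (Red full) M M′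
red*-lam-var-app ε = -, -, refl , ε , ε
red*-lam-var-app ((r , arg (arg st)) ◅ sts) =
  let P′ , M′ , eq , p , q = red*-lam-var-app sts in P′ , M′ , eq , p , (r , st) ◅ q
red*-lam-var-app ((r , fun _ st) ◅ sts) =
  let P′ , M′ , eq , p , q = red*-lam-var-app sts in P′ , M′ , eq , (r , st) ◅ p , q

red*-ret-lam : ∀ {n} {P : Comp (suc n)} {N} → Star (Red full) (ret (lam P)) N →
               ∃ λ P′ → N ≡ ret (lam P′) × Star (Red full) P P′
red*-ret-lam ε = -, refl , ε
red*-ret-lam ((r , body _ st) ◅ sts) = let P′ , eq , p = red*-ret-lam sts in P′ , eq , (r , st) ◅ p

NF-var-app : ∀ {c n} {x : Fin n} {M} → NF c M → NF c (app (var x) M)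
NF-var-app nf (_ , _ , root ())
NF-var-app nf (_ , r , arg st) = nf (-, r , st)

NF-lam-var-app : ∀ {c n} {P : Comp (suc n)} {y : Fin n} {M} → NF c P → NF c M → NF c (app (lam P) (app (var y) M))
NF-lam-var-app nfP nfM (_ , _ , root ())
NF-lam-var-app nfP nfM (_ , _ , arg (root ()))
NF-lam-var-app nfP nfM (_ , r , arg (arg st)) = nfM (-, r , st)
NF-lam-var-app nfP nfM (_ , r , fun _ st)     = nfP (-, r , st)

-- Recursion on the size of N, which fixes the shape of the weak normal form.
mutual
  surface-normalising-acc : ∀ {n} {M N : Comp n} → Acc _<_ (size N) → Star (Red full) M N → NF full N →
                            HasNormalForm (Red surface) M
  surface-normalising-acc ac p nf =
    let S , nfS , ws = weak-normalising p nf
        _ , u , v = confluent (widen* ws) p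
        S⟶*N = subst (Star (Red full) S) (sym (normalForm-Star nf v)) u
        T , nfT , ss = weakNF⇒surface ac S nfS S⟶*N nf
    in T , nfT , map (λ (r , st) → r , weak⇒surface st) ws ◅◅ ss

  weakNF⇒surface : ∀ {n} {N : Comp n} → Acc _<_ (size N) → ∀ S → NF weak S → Star (Red full) S N → NF full N →
                   HasNormalForm (Red surface) S
  weakNF⇒surface ac (ret V) nfS p nf = ret V , (λ { (_ , _ , root ()) ; (_ , _ , body () _) }) , ε
  weakNF⇒surface (acc rs) (app (var x) M) nfS p nf with red*-var-app p
  ... | N′ , refl , q =
    let T , nfT , ss = surface-normalising-acc (rs (size-arg (var x) N′)) q (NF-arg nf)
    in app (var x) T , NF-var-app nfT , red-arg* ss
  weakNF⇒surface ac (app (lam P) (ret U)) nfS p nf = ⊥-elim (nfS (-, β , root (βc P U)))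
  weakNF⇒surface ac (app (lam P) (app (lam K) L)) nfS p nf = ⊥-elim (nfS (-, σ , root (σ P K L)))
  weakNF⇒surface (acc rs) (app (lam P) (app (var y) M)) nfS p nf with red*-lam-var-app p
  ... | P′ , M′ , refl , pP , pM =
    let TP , nfP , ssP = surface-normalising-acc (rs (size-fun P′ (app (var y) M′))) pP (NF-fun tt nf)
        TM , nfM , ssM = surface-normalising-acc (rs (<-trans (size-arg (var y) M′) (size-arg (lam P′) (app (var y) M′)))) pM (NF-arg (NF-arg nf))
    in app (lam TP) (app (var y) TM) , NF-lam-var-app nfP nfM , red-fun* tt ssP ◅◅ red-arg* (red-arg* ssM)

normalising : ∀ e {n} {M N : Comp n} → Star (Red full) M N → NF full N → HasNormalForm (Red (ctx e)) M
normalising w p nf = weak-normalising p nf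
normalising s p nf = surface-normalising-acc (<-wellFounded _) p nf

⇒⇒⟶ : ∀ {e n} {M M′ : Comp n} → M ⇒[ e ] M′ → M ⟶ M′
⇒⇒⟶ (step st)      = step⇒⟶ (proj₂ (⟶[]⇒red st))
⇒⇒⟶ (inRet _ st)   = inRet (⇒⇒⟶ st)
⇒⇒⟶ (inFun _ st)   = inFun (⇒⇒⟶ st)
⇒⇒⟶ (inArg _ _ st) = inArg (⇒⇒⟶ st)

⇒⇒red : ∀ {e n} {M M′ : Comp n} → M ⇒[ e ] M′ → Red full M M′
⇒⇒red = ⟶⇒red ∘ ⇒⇒⟶

_⇒ᵉ_ : ∀ {e n} → Comp n → Comp n → Set
_⇒ᵉ_ {e} M M′ = M ⇒[ e ] M′

⇒-SN-ret : ∀ {e n} {P : Comp (suc n)} → SN (_⇒ᵉ_ {e}) P → SN (_⇒ᵉ_ {e}) (ret (lam P))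
⇒-SN-ret (acc rs) = acc λ where
  (step st)    → ⊥-elim (noStep-ret (proj₂ (⟶[]⇒red st)))
  (inRet _ st) → ⇒-SN-ret (rs st)

⇒-SN-var-app : ∀ {e n} {x : Fin n} {Q} → SN (_⇒ᵉ_ {e}) Q → NF (ctx e) (app (var x) Q) →
               SN (_⇒ᵉ_ {e}) (app (var x) Q)
⇒-SN-var-app (acc rs) nf = acc λ where
  (step st)      → ⊥-elim (nf (-, ⟶[]⇒red st))
  st′@(inArg _ _ st) → ⇒-SN-var-app (rs st) (NF-step nf (proj₂ (⇒⇒red st′)))

⇒-SN-lam-app : ∀ {e n} {P : Comp (suc n)} {Q} → SN (_⇒ᵉ_ {e}) P → SN (_⇒ᵉ_ {e}) Q →
               NF (ctx e) (app (lam P) Q) → SN (_⇒ᵉ_ {e}) (app (lam P) Q)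
⇒-SN-lam-app (acc rsP) (acc rsQ) nf = acc λ where
  (step st)      → ⊥-elim (nf (-, ⟶[]⇒red st))
  st′@(inFun _ st)   → ⇒-SN-lam-app (rsP st) (acc rsQ) (NF-step nf (proj₂ (⇒⇒red st′)))
  st′@(inArg _ _ st) → ⇒-SN-lam-app (acc rsP) (rsQ st) (NF-step nf (proj₂ (⇒⇒red st′)))

red*-normal-step : ∀ {n} {M M′ N : Comp n} → Red full M M′ → Star (Red full) M N → NF full N → Star (Red full) M′ N
red*-normal-step st p nf =
  let _ , u , v = confluent p (st ◅ ε) in subst (Star (Red full) _) (sym (normalForm-Star nf u)) v

-- Outside normal forms of →ᵉ, ⇒ᵉ is →ᵉ; inside them it descends into subterms of N.
mutual
  ⇒-SN-acc : ∀ e {n} {M N : Comp n} → Acc _<_ (size N) → Star (Red full) M N → NF full N → SN (_⇒ᵉ_ {e}) M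
  ⇒-SN-acc e ac p nf = ⇒-SN-from-SN e (WN⇒SN e (normalising e p nf)) ac p nf

  ⇒-SN-from-SN : ∀ e {n} {M N : Comp n} → SN (Red (ctx e)) M → Acc _<_ (size N) → Star (Red full) M N →
                 NF full N → SN (_⇒ᵉ_ {e}) M
  ⇒-SN-from-SN e {M = M} (acc rs) ac p nf with red? (ctx e) M
  ... | no nfM = ⇒-SN-NF e M nfM ac p nf
  ... | yes (M′ , _ , st) = acc λ where
    st′@(step st″)  → ⇒-SN-from-SN e (rs (⟶[]⇒red st″)) ac (red*-normal-step (⇒⇒red st′) p nf) nf
    (inRet nf′ _)   → ⊥-elim (nf′ (M′ , step⇒⟶[] e st))
    (inFun nf′ _)   → ⊥-elim (nf′ (M′ , step⇒⟶[] e st))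
    (inArg nf′ _ _) → ⊥-elim (nf′ (M′ , step⇒⟶[] e st))

  ⇒-SN-NF : ∀ e {n} (M : Comp n) {N} → NF (ctx e) M → Acc _<_ (size N) → Star (Red full) M N → NF full N →
            SN (_⇒ᵉ_ {e}) M
  ⇒-SN-NF e (ret (var x)) nfM ac p nf = acc λ { (step st) → ⊥-elim (noStep-ret (proj₂ (⟶[]⇒red st))) }
  ⇒-SN-NF e (ret (lam P)) nfM (acc rs) p nf with red*-ret-lam p
  ... | P′ , refl , q = ⇒-SN-ret (⇒-SN-acc e (rs (size-body P′)) q (NF-body tt nf))
  ⇒-SN-NF e (app (var x) Q) nfM (acc rs) p nf with red*-var-app p
  ... | Q′ , refl , q = ⇒-SN-var-app (⇒-SN-acc e (rs (size-arg (var x) Q′)) q (NF-arg nf)) nfM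
  ⇒-SN-NF e (app (lam P) (ret U)) nfM ac p nf = ⊥-elim (nfM (-, β , root (βc P U)))
  ⇒-SN-NF e (app (lam P) (app (lam K) L)) nfM ac p nf = ⊥-elim (nfM (-, σ , root (σ P K L)))
  ⇒-SN-NF e (app (lam P) (app (var y) Q)) nfM (acc rs) p nf with red*-lam-var-app p
  ... | P′ , Q′ , refl , pP , pQ =
    ⇒-SN-lam-app (⇒-SN-acc e (rs (size-fun P′ (app (var y) Q′))) pP (NF-fun tt nf))
                 (⇒-SN-acc e (rs (size-arg (lam P′) (app (var y) Q′))) (red-arg* pQ) (NF-arg nf))
                 nfM

mutual
  progress : ∀ e {n} (K : Comp n) {K′} → Red full K K′ → ∃ (_⇒ᵉ_ {e} K)
  progress e K (_ , st) with red? (ctx e) K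
  ... | yes (K′ , _ , st′) = K′ , step (step⇒⟶[] e st′)
  ... | no nfK             = progress-NF e K (NF⇒Normal[] nfK) st

  progress-NF : ∀ e {n} (K : Comp n) {r K′} → Normal[ e ] K → Step r full K K′ → ∃ (_⇒ᵉ_ {e} K)
  progress-NF e K nfK (root ρ) = ⊥-elim (nfK (-, step⇒⟶[] e (root ρ)))
  progress-NF e (ret (lam P)) nfK (body _ st)     = -, inRet nfK (proj₂ (progress e P (-, st)))
  progress-NF e (app (lam P) Q) nfK (fun _ st)    = -, inFun nfK (proj₂ (progress e P (-, st)))
  progress-NF e (app (var x) Q) nfK (arg st)      = -, inArg nfK tt (proj₂ (progress e Q (-, st)))
  progress-NF e (app (lam P) Q) nfK (arg st) with red? full P
  ... | yes (_ , stP) = -, inFun nfK (proj₂ (progress e P stP))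
  ... | no nfP        = -, inArg nfK (NF⇒Normal nfP) (proj₂ (progress e Q (-, st)))

SN⇒¬chain : ∀ {A : Set} {R : A → A → Set} {a} → SN R a →
            ¬ (Σ (ℕ → A) λ f → f 0 ≡ a × ∀ i → R (f i) (f (suc i)))
SN⇒¬chain {R = R} ac (f , f0 , chain) = go 0 ac f0
  where
  go : ∀ i {a} → SN R a → f i ≡ a → ⊥
  go i (acc rs) refl = go (suc i) (rs (chain i)) refl

mainTheorem8 : ∀ (e : Mode) {n : ℕ} (M N : Comp n) →
    M ⟶* N → Normal N →
    (¬ (Σ (ℕ → Comp n) λ f → (f 0 ≡ M) × (∀ i → f i ⇒[ e ] f (suc i))))
    × (∀ K → M ⇒*[ e ] K → Normal⇒[ e ] K → K ≡ N)
mainTheorem8 e M N p nf =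
    SN⇒¬chain (⇒-SN-acc e (<-wellFounded _) p′ nf′)
  , λ K ks nfK → confluent⇒normalForm-unique confluent (map ⇒⇒red ks) p′ (⇒-normal⇒NF K nfK) nf′
  where
  p′  = ⟶*⇒red* p
  nf′ = Normal⇒NF nf

  ⇒-normal⇒NF : ∀ K → Normal⇒[ e ] K → NF full K
  ⇒-normal⇒NF K nfK (_ , st) = nfK (progress e K st)
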